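{- None of the following graphs has an $H^2$: (a) $G_2$: for $m\ge 4$, the graph obtained from two vertex-disjoint copies of $K_m$ by adding a perfect matching between them; (b) $G_3=K_m+\overline{K_{m-1}}$ for $m\ge 4$; (c) $G_4$: the graph obtained from the square $C^2$ of a cycle $C$ by adding a new vertex $v_4$ adjacent to exactly four vertices of $C^2$, where these four vertices induce $P_3\sqcup K_1$ in $C^2$; (d) $G_5$: let $T$ be the perfect 4-ary rooted tree of depth 2 (the root has 4 children, each child has 3 further children, which are the 12 leaves), embedded in the plane with leaves named from left to right $x_1,y_1,z_1,x_2,y_2,z_2,x_3,y_3,z_3,x_4,y_4,z_4$; $G_5$ is obtained from $T$ by adding the edges of the cycle $x_1x_2x_3x_4y_1y_2y_3y_4z_1z_2z_3z_4x_1$; (e) $G_6=(K_2\sqcup K_2)+(K_m\sqcup K_1)$ for $m\ge 4$.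
   Context: All graphs are finite and simple. $K_m$ is the complete graph on $m$ vertices, $\overline{H}$ the complement of $H$, $P_3$ the path on 3 vertices. $G\sqcup H$ is the vertex-disjoint union and $G+H$ the join (disjoint union plus all edges between $V(G)$ and $V(H)$). The square of a graph is obtained by adding edges joining all pairs of vertices at distance two. A graph $G$ has an $H^2$ if $G$ contains, as a subgraph, the square of some hamiltonian cycle of $G$. -}

module Defs where

open import Data.Nat using (ℕ; zero; suc; _+_; _*_)
open import Data.Nat.DivMod using (_mod_)
open import Data.Fin using (Fin; toℕ)
open import Data.Fin.Permutation using (Permutation′; _⟨$⟩ʳ_)
open import Data.Sum using (_⊎_; inj₁; inj₂)
open import Data.Product using (Σ; ∃; _×_; _,_; proj₁; proj₂)
open import Data.Unit using (⊤; tt)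
open import Data.Empty using (⊥)
open import Relation.Nullary using (¬_)
open import Relation.Binary.PropositionalEquality using (_≡_; _≢_; refl; sym)
open import Function.Definitions using (Bijective)

record Graph : Set₁ where
  field
    V      : Set
    _~_    : V → V → Set
    ~-sym  : ∀ {u v} → u ~ v → v ~ u
    ~-irr  : ∀ {u} → ¬ (u ~ u)

open Graph public

K : ℕ → Graph
K m = record { V = Fin m ; _~_ = λ i j → i ≢ j ; ~-sym = λ p q → p (sym q) ; ~-irr = λ p → p refl }

co : Graph → Graph
co G = record
  { V = V G
  ; _~_ = λ u v → u ≢ v × ¬ (_~_ G u v)
  ; ~-sym = λ { (p , q) → (λ e → p (sym e)) , (λ a → q (~-sym G a)) }
  ; ~-irr = λ { (p , _) → p refl }
  }

⊔Adj : (G H : Graph) → V G ⊎ V H → V G ⊎ V H → Set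
⊔Adj G H (inj₁ x) (inj₁ y) = _~_ G x y
⊔Adj G H (inj₂ x) (inj₂ y) = _~_ H x y
⊔Adj G H (inj₁ x) (inj₂ y) = ⊥
⊔Adj G H (inj₂ x) (inj₁ y) = ⊥

⊔Sym : (G H : Graph) → ∀ {u v} → ⊔Adj G H u v → ⊔Adj G H v u
⊔Sym G H {inj₁ x} {inj₁ y} a = ~-sym G a
⊔Sym G H {inj₂ x} {inj₂ y} a = ~-sym H a

⊔Irr : (G H : Graph) → ∀ {u} → ¬ ⊔Adj G H u u
⊔Irr G H {inj₁ x} = ~-irr G
⊔Irr G H {inj₂ x} = ~-irr H

_⊔_ : Graph → Graph → Graph
G ⊔ H = record { V = V G ⊎ V H ; _~_ = ⊔Adj G H ; ~-sym = λ {u} {v} → ⊔Sym G H {u} {v} ; ~-irr = λ {u} → ⊔Irr G H {u} }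

joinAdj : (G H : Graph) → V G ⊎ V H → V G ⊎ V H → Set
joinAdj G H (inj₁ x) (inj₁ y) = _~_ G x y
joinAdj G H (inj₂ x) (inj₂ y) = _~_ H x y
joinAdj G H (inj₁ x) (inj₂ y) = ⊤
joinAdj G H (inj₂ x) (inj₁ y) = ⊤

joinSym : (G H : Graph) → ∀ {u v} → joinAdj G H u v → joinAdj G H v u
joinSym G H {inj₁ x} {inj₁ y} a = ~-sym G a
joinSym G H {inj₂ x} {inj₂ y} a = ~-sym H a
joinSym G H {inj₁ x} {inj₂ y} a = tt
joinSym G H {inj₂ x} {inj₁ y} a = tt

joinIrr : (G H : Graph) → ∀ {u} → ¬ joinAdj G H u u
joinIrr G H {inj₁ x} = ~-irr G
joinIrr G H {inj₂ x} = ~-irr H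

_+ᴳ_ : Graph → Graph → Graph
G +ᴳ H = record { V = V G ⊎ V H ; _~_ = joinAdj G H ; ~-sym = λ {u} {v} → joinSym G H {u} {v} ; ~-irr = λ {u} → joinIrr G H {u} }

Square : Graph → Graph
Square G = record
  { V = V G
  ; _~_ = λ u v → u ≢ v × (_~_ G u v ⊎ ∃ λ w → _~_ G u w × _~_ G w v)
  ; ~-sym = λ { (p , inj₁ a) → (λ e → p (sym e)) , inj₁ (~-sym G a)
              ; (p , inj₂ (w , a , b)) → (λ e → p (sym e)) , inj₂ (w , ~-sym G b , ~-sym G a) }
  ; ~-irr = λ { (p , _) → p refl }
  }

_⊕_ : ∀ {n} → Fin (suc n) → ℕ → Fin (suc n)
_⊕_ {n} i t = (toℕ i + t) mod (suc n)

Cyc : ℕ → Graph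
Cyc k = record
  { V = Fin (3 + k)
  ; _~_ = λ i j → i ≢ j × (j ≡ i ⊕ 1 ⊎ i ≡ j ⊕ 1)
  ; ~-sym = λ { (p , inj₁ e) → (λ x → p (sym x)) , inj₂ e
              ; (p , inj₂ e) → (λ x → p (sym x)) , inj₁ e }
  ; ~-irr = λ { (p , _) → p refl }
  }

-- a hamiltonian cycle of G: a cyclic ordering σ of all vertices of G
-- (σ a bijection from Fin (3+k)) whose consecutive vertices are adjacent,
-- i.e. σ embeds the cycle C_{3+k} into G as a spanning subgraph
HamCycle : Graph → Set
HamCycle G = Σ ℕ λ k → Σ (Fin (3 + k) → V G) λ σ →
  Bijective _≡_ _≡_ σ × (∀ i j → _~_ (Cyc k) i j → _~_ G (σ i) (σ j))

-- G has an H²: G contains, as a subgraph, the square of some hamiltonian cycle of G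
HasH² : Graph → Set
HasH² G = Σ (HamCycle G) λ C →
  let k = proj₁ C ; σ = proj₁ (proj₂ C) in
  ∀ i j → _~_ (Square (Cyc k)) i j → _~_ G (σ i) (σ j)

G₂Adj : (m : ℕ) → Permutation′ m → Fin m ⊎ Fin m → Fin m ⊎ Fin m → Set
G₂Adj m π (inj₁ i) (inj₁ j) = i ≢ j
G₂Adj m π (inj₂ i) (inj₂ j) = i ≢ j
G₂Adj m π (inj₁ i) (inj₂ j) = π ⟨$⟩ʳ i ≡ j
G₂Adj m π (inj₂ j) (inj₁ i) = π ⟨$⟩ʳ i ≡ j

G₂Sym : ∀ m π {u v} → G₂Adj m π u v → G₂Adj m π v u
G₂Sym m π {inj₁ i} {inj₁ j} p e = p (sym e)
G₂Sym m π {inj₂ i} {inj₂ j} p e = p (sym e)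
G₂Sym m π {inj₁ i} {inj₂ j} p = p
G₂Sym m π {inj₂ j} {inj₁ i} p = p

G₂Irr : ∀ m π {u} → ¬ G₂Adj m π u u
G₂Irr m π {inj₁ i} p = p refl
G₂Irr m π {inj₂ i} p = p refl

G₂ : (m : ℕ) → Permutation′ m → Graph
G₂ m π = record { V = Fin m ⊎ Fin m ; _~_ = G₂Adj m π ; ~-sym = λ {u} {v} → G₂Sym m π {u} {v} ; ~-irr = λ {u} → G₂Irr m π {u} }

InducesP₃⊔K₁ : (G : Graph) → V G → V G → V G → V G → Set
InducesP₃⊔K₁ G a b c d =
  (a ≢ b × a ≢ c × a ≢ d × b ≢ c × b ≢ d × c ≢ d) ×
  (_~_ G a b × _~_ G b c × ¬ _~_ G a c × ¬ _~_ G a d × ¬ _~_ G b d × ¬ _~_ G c d)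

Nbr4 : ∀ {A : Set} → A → A → A → A → A → Set
Nbr4 a b c d x = x ≡ a ⊎ x ≡ b ⊎ x ≡ c ⊎ x ≡ d

G₄Adj : (k : ℕ) (a b c d : Fin (3 + k)) → Fin (3 + k) ⊎ ⊤ → Fin (3 + k) ⊎ ⊤ → Set
G₄Adj k a b c d (inj₁ x) (inj₁ y) = _~_ (Square (Cyc k)) x y
G₄Adj k a b c d (inj₁ x) (inj₂ _) = Nbr4 a b c d x
G₄Adj k a b c d (inj₂ _) (inj₁ y) = Nbr4 a b c d y
G₄Adj k a b c d (inj₂ _) (inj₂ _) = ⊥

G₄Sym : ∀ k a b c d {u v} → G₄Adj k a b c d u v → G₄Adj k a b c d v u
G₄Sym k a b c d {inj₁ x} {inj₁ y} p = ~-sym (Square (Cyc k)) p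
G₄Sym k a b c d {inj₁ x} {inj₂ _} p = p
G₄Sym k a b c d {inj₂ _} {inj₁ y} p = p

G₄Irr : ∀ k a b c d {u} → ¬ G₄Adj k a b c d u u
G₄Irr k a b c d {inj₁ x} = ~-irr (Square (Cyc k))
G₄Irr k a b c d {inj₂ _} ()

G₄ : (k : ℕ) (a b c d : Fin (3 + k)) → Graph
G₄ k a b c d = record { V = Fin (3 + k) ⊎ ⊤ ; _~_ = G₄Adj k a b c d
                      ; ~-sym = λ {u} {v} → G₄Sym k a b c d {u} {v} ; ~-irr = λ {u} → G₄Irr k a b c d {u} }

-- leaf i j (i : Fin 4, j : Fin 3) is the j-th child of mid i;
-- x_{i+1} = leaf i 0, y_{i+1} = leaf i 1, z_{i+1} = leaf i 2
data T5 : Set where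
  root : T5
  mid  : Fin 4 → T5
  leaf : Fin 4 → Fin 3 → T5

-- position of a leaf on the cycle x₁x₂x₃x₄y₁y₂y₃y₄z₁z₂z₃z₄(x₁)
pos : Fin 4 → Fin 3 → Fin 12
pos i j = (toℕ j * 4 + toℕ i) mod 12

G₅Adj : T5 → T5 → Set
G₅Adj root (mid i) = ⊤
G₅Adj (mid i) root = ⊤
G₅Adj (mid i) (leaf i' j) = i ≡ i'
G₅Adj (leaf i' j) (mid i) = i ≡ i'
G₅Adj (leaf i j) (leaf i' j') =
  ¬ (i ≡ i' × j ≡ j') × (pos i' j' ≡ pos i j ⊕ 1 ⊎ pos i j ≡ pos i' j' ⊕ 1)
G₅Adj _ _ = ⊥

G₅Sym : ∀ {u v} → G₅Adj u v → G₅Adj v u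
G₅Sym {root} {mid i} p = tt
G₅Sym {mid i} {root} p = tt
G₅Sym {mid i} {leaf i' j} p = p
G₅Sym {leaf i' j} {mid i} p = p
G₅Sym {leaf i j} {leaf i' j'} (p , inj₁ e) = (λ { (x , y) → p (sym x , sym y) }) , inj₂ e
G₅Sym {leaf i j} {leaf i' j'} (p , inj₂ e) = (λ { (x , y) → p (sym x , sym y) }) , inj₁ e

G₅Irr : ∀ {u} → ¬ G₅Adj u u
G₅Irr {root} ()
G₅Irr {mid i} ()
G₅Irr {leaf i j} (p , _) = p (refl , refl)

G₅ : Graph
G₅ = record { V = T5 ; _~_ = G₅Adj ; ~-sym = λ {u} {v} → G₅Sym {u} {v} ; ~-irr = λ {u} → G₅Irr {u} }

-- Let σ : Fin N → V(G) list the vertices of G along a hamiltonian cycle whose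
-- square lies in G. After the modular arithmetic of the cyclic successor i ↦ i+1,
-- we derive local consequences of an H², each valid for every graph:
--   * σ(i) σ(i+1) σ(i+2) is a triangle, so every vertex has two adjacent
--     neighbours, and a colouring agreeing on the ends of every edge in a
--     triangle is constant (walk once around the cycle);
--   * if N ≥ 5 (e.g. G has five distinct vertices), the neighbourhood of σ(i+2)
--     contains the path σ(i) σ(i+1) σ(i+3) σ(i+4) on four distinct vertices;
--   * the successors of an independent set of m vertices are 2m distinct neighbours.
-- Each graph violates one of them: (a) a triangle of G₂ stays inside one clique;
-- (b) the m-1 independent vertices of K_m + co K_{m-1} have only m neighbours;
-- (c), (e) the special vertex of G₄ resp. G₆ sees P₃ ⊔ K₁ resp. K₂ ⊔ K₂, which
-- contain no such path; (d) the root of G₅ lies in no triangle.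

module Submission where

open import Defs
open import Data.Nat using (ℕ; zero; suc; _+_; _*_; _∸_; _≤_; _<_; z≤n; s≤s; _%_; _/_)
open import Data.Nat.Properties
  using (+-identityʳ; +-assoc; +-comm; +-cancelˡ-≡; +-cancelˡ-≤; ≤-trans; n≤1+n; m≤m+n; <-irrefl; ≤⇒≯)
open import Data.Nat.DivMod using (m≡m%n+[m/n]*n; m%n%n≡m%n; [m+n]%n≡m%n; m<n⇒m%n≡m; %-distribˡ-+)
open import Data.Fin using (Fin; zero; suc; toℕ; splitAt)
open import Data.Fin.Properties using (toℕ-injective; toℕ<n; toℕ-fromℕ<; injective⇒≤; +↔⊎)
open import Data.Fin.Permutation using (Permutation′)
open import Data.List using (List; []; _∷_; length; lookup)
open import Data.List.Relation.Unary.All as All using ([]; _∷_)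
open import Data.List.Relation.Unary.AllPairs using ([]; _∷_)
open import Data.List.Relation.Unary.Unique.Propositional using (Unique)
open import Data.List.Membership.Propositional.Properties using (∈-lookup)
open import Data.Product using (Σ; ∃; ∃₂; _×_; _,_; proj₁; proj₂)
open import Data.Sum using (_⊎_; inj₁; inj₂; reduce)
open import Data.Sum.Properties using (inj₁-injective; inj₂-injective)
open import Data.Unit using (tt)
open import Data.Bool using (Bool; true; false)
open import Data.Empty using (⊥; ⊥-elim)
open import Relation.Nullary using (¬_)
open import Relation.Binary.PropositionalEquality
  using (_≡_; _≢_; refl; sym; trans; cong; subst; module ≡-Reasoning)
open import Function using (_∘_)
open import Function.Bundles using (Injection)
open import Function.Definitions using (Injective)
open import Function.Properties.Inverse using (↔⇒↣)

module Rotation (n : ℕ) where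

  N : ℕ
  N = suc n

  next : Fin N → Fin N
  next i = i ⊕ 1

  rotate : ℕ → Fin N → Fin N
  rotate zero    i = i
  rotate (suc t) i = next (rotate t i)

  %-absorbˡ : ∀ a b → (a % N + b) % N ≡ (a + b) % N
  %-absorbˡ a b = begin
    (a % N + b) % N               ≡⟨ %-distribˡ-+ (a % N) b N ⟩
    (a % N % N + b % N) % N       ≡⟨ cong (λ x → (x + b % N) % N) (m%n%n≡m%n a N) ⟩
    (a % N + b % N) % N           ≡⟨ %-distribˡ-+ a b N ⟨
    (a + b) % N                   ∎
    where open ≡-Reasoning

  toℕ-rotate : ∀ t i → toℕ (rotate t i) ≡ (toℕ i + t) % N
  toℕ-rotate zero i = sym (trans (cong (_% N) (+-identityʳ (toℕ i))) (m<n⇒m%n≡m (toℕ<n i)))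
  toℕ-rotate (suc t) i = begin
    toℕ (next (rotate t i))       ≡⟨ toℕ-fromℕ< _ ⟩
    (toℕ (rotate t i) + 1) % N    ≡⟨ cong (λ x → (x + 1) % N) (toℕ-rotate t i) ⟩
    ((toℕ i + t) % N + 1) % N     ≡⟨ %-absorbˡ (toℕ i + t) 1 ⟩
    (toℕ i + t + 1) % N           ≡⟨ cong (_% N) (trans (+-assoc (toℕ i) t 1) (cong (toℕ i +_) (+-comm t 1))) ⟩
    (toℕ i + suc t) % N           ∎
    where open ≡-Reasoning

  rotate-+ : ∀ t u i → rotate t (rotate u i) ≡ rotate (t + u) i
  rotate-+ zero    u i = refl
  rotate-+ (suc t) u i = cong next (rotate-+ t u i)

  rotate-period : ∀ i → rotate N i ≡ i
  rotate-period i = toℕ-injective (begin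
    toℕ (rotate N i)   ≡⟨ toℕ-rotate N i ⟩
    (toℕ i + N) % N    ≡⟨ [m+n]%n≡m%n (toℕ i) N ⟩
    toℕ i % N          ≡⟨ m<n⇒m%n≡m (toℕ<n i) ⟩
    toℕ i              ∎)
    where open ≡-Reasoning

  rotate-from-zero : ∀ j → rotate (toℕ j) zero ≡ j
  rotate-from-zero j = toℕ-injective (trans (toℕ-rotate (toℕ j) zero) (m<n⇒m%n≡m (toℕ<n j)))

  -- a proper, non-trivial rotation has no fixed point: if (x + t) % N ≡ x
  -- then t is a multiple of N, impossible for 0 < t < N
  rotate-moves : ∀ t i → 0 < t → t < N → rotate t i ≢ i
  rotate-moves t i 0<t t<N fixed = impossible q t≡q*N
    where
    x q : ℕ
    x = toℕ i
    q = (x + t) / N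
    t≡q*N : t ≡ q * N
    t≡q*N = +-cancelˡ-≡ x t (q * N) (begin
      x + t                    ≡⟨ m≡m%n+[m/n]*n (x + t) N ⟩
      (x + t) % N + q * N      ≡⟨ cong (_+ q * N) (trans (sym (toℕ-rotate t i)) (cong toℕ fixed)) ⟩
      x + q * N                ∎)
      where open ≡-Reasoning
    impossible : ∀ p → t ≡ p * N → ⊥
    impossible zero    refl = <-irrefl refl 0<t
    impossible (suc p) refl = ≤⇒≯ (m≤m+n N (p * N)) t<N

  prev : Fin N → Fin N
  prev = rotate n

  next-prev : ∀ i → next (prev i) ≡ i
  next-prev i = rotate-period i

  prev-next : ∀ i → prev (next i) ≡ i
  prev-next i = trans (rotate-+ n 1 i) (trans (cong (λ t → rotate t i) (+-comm n 1)) (rotate-period i))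

  next-injective : ∀ {i j} → next i ≡ next j → i ≡ j
  next-injective {i} {j} e = trans (sym (prev-next i)) (trans (cong prev e) (prev-next j))

  invariant⇒constant : ∀ {A : Set} (f : Fin N → A) → (∀ i → f (next i) ≡ f i) → ∀ j → f j ≡ f zero
  invariant⇒constant f invariant j = trans (cong f (sym (rotate-from-zero j))) (along (toℕ j) zero)
    where
    along : ∀ t i → f (rotate t i) ≡ f i
    along zero    i = refl
    along (suc t) i = trans (invariant (rotate t i)) (along t i)

lookup-injective : ∀ {A : Set} {xs : List A} → Unique xs → Injective _≡_ _≡_ (lookup xs)
lookup-injective {xs = x ∷ xs} _          {zero}  {zero}  _ = refl
lookup-injective {xs = x ∷ xs} (x∉xs ∷ _) {zero}  {suc j} e = ⊥-elim (All.lookup x∉xs (∈-lookup j) e)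
lookup-injective {xs = x ∷ xs} (x∉xs ∷ _) {suc i} {zero}  e = ⊥-elim (All.lookup x∉xs (∈-lookup i) (sym e))
lookup-injective {xs = x ∷ xs} (_ ∷ unique) {suc i} {suc j} e = cong suc (lookup-injective unique e)

-- a path x₁x₂x₃x₄ on four distinct vertices inside the neighbourhood of w
-- (x₂ ≢ x₃ follows from x₂ ~ x₃)
record NeighbourhoodP₄ (G : Graph) (w : V G) : Set where
  constructor p₄
  field
    x₁ x₂ x₃ x₄ : V G
    w~x₁ : _~_ G w x₁
    w~x₂ : _~_ G w x₂
    w~x₃ : _~_ G w x₃
    w~x₄ : _~_ G w x₄
    x₁~x₂ : _~_ G x₁ x₂
    x₂~x₃ : _~_ G x₂ x₃
    x₃~x₄ : _~_ G x₃ x₄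
    x₁≢x₃ : x₁ ≢ x₃
    x₁≢x₄ : x₁ ≢ x₄
    x₂≢x₄ : x₂ ≢ x₄

module SquaredCycle (G : Graph) (H : HasH² G) where

  private
    _∼_ : V G → V G → Set
    _∼_ = _~_ G

  k : ℕ
  k = proj₁ (proj₁ H)

  open Rotation (2 + k)

  σ : Fin (3 + k) → V G
  σ = proj₁ (proj₂ (proj₁ H))

  σ-injective : Injective _≡_ _≡_ σ
  σ-injective = proj₁ (proj₁ (proj₂ (proj₂ (proj₁ H))))

  square : ∀ i j → _~_ (Square (Cyc k)) i j → σ i ∼ σ j
  square = proj₂ H

  position : V G → Fin (3 + k)
  position w = proj₁ (proj₂ (proj₁ (proj₂ (proj₂ (proj₁ H)))) w)

  σ-position : ∀ w → σ (position w) ≡ w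
  σ-position w = proj₂ (proj₂ (proj₁ (proj₂ (proj₂ (proj₁ H)))) w) refl

  position-injective : ∀ {u v} → position u ≡ position v → u ≡ v
  position-injective {u} {v} e = trans (sym (σ-position u)) (trans (cong σ e) (σ-position v))

  lengthBound : (xs : List (V G)) → Unique xs → length xs ≤ 3 + k
  lengthBound xs unique =
    injective⇒≤ {f = position ∘ lookup xs} (lookup-injective unique ∘ position-injective)

  cycleEdge : ∀ i → _~_ (Cyc k) i (next i)
  cycleEdge i = (λ e → rotate-moves 1 i (s≤s z≤n) (s≤s (s≤s z≤n)) (sym e)) , inj₁ refl

  edge₁ : ∀ i → σ i ∼ σ (next i)
  edge₁ i = square i (next i) (proj₁ (cycleEdge i) , inj₁ (cycleEdge i))

  edge₂ : ∀ i → σ i ∼ σ (next (next i))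
  edge₂ i = square i (next (next i))
    ( (λ e → rotate-moves 2 i (s≤s z≤n) (s≤s (s≤s (s≤s z≤n))) (sym e))
    , inj₂ (next i , cycleEdge i , cycleEdge (next i)))

  adjacentNeighbours : ∀ w → ∃₂ λ x y → w ∼ x × w ∼ y × x ∼ y
  adjacentNeighbours w =
    σ (next i) , σ (next (next i)) ,
    subst (_∼ σ (next i)) (σ-position w) (edge₁ i) ,
    subst (_∼ σ (next (next i))) (σ-position w) (edge₂ i) ,
    edge₁ (next i)
    where i = position w

  -- a colouring that agrees on the ends of every edge lying in a triangle is
  -- constant: consecutive vertices of the cycle span such an edge
  triangleColouring-constant : ∀ {A : Set} (c : V G → A) →
    (∀ {u v w} → u ∼ v → v ∼ w → u ∼ w → c u ≡ c v) → ∀ u v → c u ≡ c v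
  triangleColouring-constant c agrees u v = begin
    c u                   ≡⟨ cong c (σ-position u) ⟨
    c (σ (position u))    ≡⟨ invariant⇒constant (c ∘ σ) invariant (position u) ⟩
    c (σ zero)            ≡⟨ invariant⇒constant (c ∘ σ) invariant (position v) ⟨
    c (σ (position v))    ≡⟨ cong c (σ-position v) ⟩
    c v                   ∎
    where
    open ≡-Reasoning
    invariant : ∀ i → c (σ (next i)) ≡ c (σ i)
    invariant i = sym (agrees (edge₁ i) (edge₁ (next i)) (edge₂ i))

  neighbourhoodP₄ : 5 ≤ 3 + k → ∀ w → NeighbourhoodP₄ G w
  neighbourhoodP₄ long w = subst (NeighbourhoodP₄ G) σq+2≡w (around (prev (prev (position w))))
    where
    σq+2≡w : σ (next (next (prev (prev (position w))))) ≡ w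
    σq+2≡w = trans (cong (σ ∘ next) (next-prev (prev (position w))))
                   (trans (cong σ (next-prev (position w))) (σ-position w))
    3<N : 3 < 3 + k
    3<N = ≤-trans (n≤1+n 4) long
    around : ∀ q → NeighbourhoodP₄ G (σ (next (next q)))
    around q = p₄ (σ q) (σ (next q)) (σ (rotate 3 q)) (σ (rotate 4 q))
      (~-sym G (edge₂ q)) (~-sym G (edge₁ (next q))) (edge₁ (next (next q))) (edge₂ (next (next q)))
      (edge₁ q) (edge₂ (next q)) (edge₁ (rotate 3 q))
      (λ e → rotate-moves 3 q (s≤s z≤n) 3<N (σ-injective (sym e)))
      (λ e → rotate-moves 4 q (s≤s z≤n) long (σ-injective (sym e)))
      (λ e → rotate-moves 3 (next q) (s≤s z≤n) 3<N (σ-injective (sym e)))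

  independentSuccessors : ∀ {m} (v : Fin m → V G) → Injective _≡_ _≡_ v → (∀ i j → ¬ (v i ∼ v j)) →
    Σ (Fin m ⊎ Fin m → V G) λ f → Injective _≡_ _≡_ f × (∀ z → v (reduce z) ∼ f z)
  independentSuccessors {m} v v-injective independent = f , f-injective , adjacent
    where
    p : Fin m → Fin (3 + k)
    p y = position (v y)
    f : Fin m ⊎ Fin m → V G
    f (inj₁ y) = σ (next (p y))
    f (inj₂ y) = σ (next (next (p y)))
    adjacent : ∀ z → v (reduce z) ∼ f z
    adjacent (inj₁ y) = subst (_∼ f (inj₁ y)) (σ-position (v y)) (edge₁ (p y))
    adjacent (inj₂ y) = subst (_∼ f (inj₂ y)) (σ-position (v y)) (edge₂ (p y))
    -- a vertex of the set sitting right after another one would be adjacent to it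
    notAfter : ∀ y y′ → p y ≢ next (p y′)
    notAfter y y′ e = independent y′ y (subst (v y′ ∼_) (trans (sym (cong σ e)) (σ-position (v y))) (adjacent (inj₁ y′)))
    samePosition : ∀ {y y′} → p y ≡ p y′ → y ≡ y′
    samePosition = v-injective ∘ position-injective
    f-injective : Injective _≡_ _≡_ f
    f-injective {inj₁ y} {inj₁ y′} e = cong inj₁ (samePosition (next-injective (σ-injective e)))
    f-injective {inj₂ y} {inj₂ y′} e = cong inj₂ (samePosition (next-injective (next-injective (σ-injective e))))
    f-injective {inj₁ y} {inj₂ y′} e = ⊥-elim (notAfter y y′ (next-injective (σ-injective e)))
    f-injective {inj₂ y} {inj₁ y′} e = ⊥-elim (notAfter y′ y (sym (next-injective (σ-injective e))))

  independentNeighbourhoodBound : ∀ {m M} (v : Fin m → V G) → Injective _≡_ _≡_ v →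
    (∀ i j → ¬ (v i ∼ v j)) → (ι : Fin M → V G) → (∀ i u → v i ∼ u → ∃ λ x → u ≡ ι x) → m + m ≤ M
  independentNeighbourhoodBound {m} {M} v v-injective independent ι covers
    with independentSuccessors v v-injective independent
  ... | f , f-injective , adjacent =
    injective⇒≤ {f = g ∘ splitAt m} (Injection.injective (↔⇒↣ (+↔⊎ {m} {m})) ∘ g-injective)
    where
    g : Fin m ⊎ Fin m → Fin M
    g z = proj₁ (covers (reduce z) (f z) (adjacent z))
    g-injective : Injective _≡_ _≡_ g
    g-injective {z} {z′} e = f-injective (begin
      f z        ≡⟨ proj₂ (covers (reduce z) (f z) (adjacent z)) ⟩
      ι (g z)    ≡⟨ cong ι e ⟩
      ι (g z′)   ≡⟨ proj₂ (covers (reduce z′) (f z′) (adjacent z′)) ⟨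
      f z′       ∎)
      where open ≡-Reasoning

side : ∀ {A B : Set} → A ⊎ B → Bool
side (inj₁ _) = true
side (inj₂ _) = false

-- two adjacent vertices on different sides have no common neighbour, since
-- each vertex has a single matching partner on the other side
G₂-triangle-oneSide : ∀ {m} (π : Permutation′ m) {u v w : Fin m ⊎ Fin m} →
  G₂Adj m π u v → G₂Adj m π v w → G₂Adj m π u w → side u ≡ side v
G₂-triangle-oneSide π {inj₁ _} {inj₁ _} _ _ _ = refl
G₂-triangle-oneSide π {inj₂ _} {inj₂ _} _ _ _ = refl
G₂-triangle-oneSide π {inj₁ x} {inj₂ y} {inj₁ z} πx≡y πz≡y x≢z =
  ⊥-elim (x≢z (Injection.injective (↔⇒↣ π) (trans πx≡y (sym πz≡y))))
G₂-triangle-oneSide π {inj₁ x} {inj₂ y} {inj₂ z} πx≡y y≢z πx≡z = ⊥-elim (y≢z (trans (sym πx≡y) πx≡z))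
G₂-triangle-oneSide π {inj₂ y} {inj₁ x} {inj₁ z} πx≡y x≢z πz≡y =
  ⊥-elim (x≢z (Injection.injective (↔⇒↣ π) (trans πx≡y (sym πz≡y))))
G₂-triangle-oneSide π {inj₂ y} {inj₁ x} {inj₂ z} πx≡y πx≡z y≢z = ⊥-elim (y≢z (trans (sym πx≡y) πx≡z))

-- the side would be constant on G₂, although both cliques are non-empty
partA : ∀ (m : ℕ) → 4 ≤ m → (π : Permutation′ m) → ¬ HasH² (G₂ m π)
partA (suc m) _ π H =
  sidesDiffer (triangleColouring-constant side (G₂-triangle-oneSide π) (inj₁ zero) (inj₂ zero))
  where
  open SquaredCycle (G₂ (suc m) π) H
  sidesDiffer : true ≢ false
  sidesDiffer ()

co-K-edgeless : ∀ {m} (x y : Fin m) → ¬ _~_ (co (K m)) x y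
co-K-edgeless x y (x≢y , ¬x≢y) = ¬x≢y x≢y

cliqueNeighbour : ∀ {m m′} (y : Fin m′) (u : Fin m ⊎ Fin m′) →
  joinAdj (K m) (co (K m′)) (inj₂ y) u → ∃ λ x → u ≡ inj₁ x
cliqueNeighbour y (inj₁ x)  _   = x , refl
cliqueNeighbour y (inj₂ y′) y~y′ = ⊥-elim (co-K-edgeless y y′ y~y′)

doubleExceeds : ∀ m′ → 2 ≤ m′ → ¬ (m′ + m′ ≤ suc m′)
doubleExceeds m′ 2≤m′ le = ≤⇒≯ (+-cancelˡ-≤ m′ m′ 1 (subst (m′ + m′ ≤_) (+-comm 1 m′) le)) 2≤m′

-- the m-1 independent vertices would need 2(m-1) neighbours among the m clique vertices
partB : ∀ (m : ℕ) → 4 ≤ m → ¬ HasH² (K m +ᴳ co (K (m ∸ 1)))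
partB (suc m′) (s≤s 3≤m′) H =
  doubleExceeds m′ (≤-trans (n≤1+n 2) 3≤m′)
    (independentNeighbourhoodBound inj₂ inj₂-injective co-K-edgeless inj₁ cliqueNeighbour)
  where open SquaredCycle (K (suc m′) +ᴳ co (K m′)) H

-- In a set {a, b, c, d} inducing the path abc plus the isolated vertex d there
-- is no path y₁y₂y₃y₄ with {y₁, y₂} disjoint from {y₃, y₄}: every yᵢ has a
-- neighbour in the set, so it is one of a, b, c, and every edge among a, b, c
-- contains b.
P₃⊔K₁-noP₄ : ∀ (H : Graph) {a b c d y₁ y₂ y₃ y₄ : V H} → InducesP₃⊔K₁ H a b c d →
  Nbr4 a b c d y₁ → Nbr4 a b c d y₂ → Nbr4 a b c d y₃ → Nbr4 a b c d y₄ →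
  _~_ H y₁ y₂ → _~_ H y₂ y₃ → _~_ H y₃ y₄ → y₁ ≢ y₃ → y₁ ≢ y₄ → y₂ ≢ y₄ → ⊥
P₃⊔K₁-noP₄ H {a} {b} {c} {d} {y₁} {y₂} {y₃} {y₄} (_ , (_ , _ , ¬ac , ¬ad , ¬bd , ¬cd))
  n₁ n₂ n₃ n₄ y₁y₂ y₂y₃ y₃y₄ y₁≢y₃ y₁≢y₄ y₂≢y₄ =
  disjoint (throughB (onPath n₁ n₂ y₁y₂) (onPath n₂ n₁ (~-sym H y₁y₂)) y₁y₂)
           (throughB (onPath n₃ n₄ y₃y₄) (onPath n₄ n₃ (~-sym H y₃y₄)) y₃y₄)
  where
  OnPath : V H → Set
  OnPath y = y ≡ a ⊎ y ≡ b ⊎ y ≡ c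
  onPath : ∀ {y z} → Nbr4 a b c d y → Nbr4 a b c d z → _~_ H y z → OnPath y
  onPath (inj₁ y≡a)                _ _ = inj₁ y≡a
  onPath (inj₂ (inj₁ y≡b))         _ _ = inj₂ (inj₁ y≡b)
  onPath (inj₂ (inj₂ (inj₁ y≡c)))  _ _ = inj₂ (inj₂ y≡c)
  onPath (inj₂ (inj₂ (inj₂ refl))) (inj₁ refl)                da = ⊥-elim (¬ad (~-sym H da))
  onPath (inj₂ (inj₂ (inj₂ refl))) (inj₂ (inj₁ refl))         db = ⊥-elim (¬bd (~-sym H db))
  onPath (inj₂ (inj₂ (inj₂ refl))) (inj₂ (inj₂ (inj₁ refl)))  dc = ⊥-elim (¬cd (~-sym H dc))
  onPath (inj₂ (inj₂ (inj₂ refl))) (inj₂ (inj₂ (inj₂ refl)))  dd = ⊥-elim (~-irr H dd)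
  throughB : ∀ {y z} → OnPath y → OnPath z → _~_ H y z → y ≡ b ⊎ z ≡ b
  throughB (inj₂ (inj₁ y≡b)) _ _ = inj₁ y≡b
  throughB _ (inj₂ (inj₁ z≡b)) _ = inj₂ z≡b
  throughB (inj₁ refl)        (inj₁ refl)        aa = ⊥-elim (~-irr H aa)
  throughB (inj₁ refl)        (inj₂ (inj₂ refl)) ac = ⊥-elim (¬ac ac)
  throughB (inj₂ (inj₂ refl)) (inj₁ refl)        ca = ⊥-elim (¬ac (~-sym H ca))
  throughB (inj₂ (inj₂ refl)) (inj₂ (inj₂ refl)) cc = ⊥-elim (~-irr H cc)
  y₂≢y₃ : y₂ ≢ y₃
  y₂≢y₃ refl = ~-irr H y₂y₃
  disjoint : y₁ ≡ b ⊎ y₂ ≡ b → y₃ ≡ b ⊎ y₄ ≡ b → ⊥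
  disjoint (inj₁ p) (inj₁ q) = y₁≢y₃ (trans p (sym q))
  disjoint (inj₁ p) (inj₂ q) = y₁≢y₄ (trans p (sym q))
  disjoint (inj₂ p) (inj₁ q) = y₂≢y₃ (trans p (sym q))
  disjoint (inj₂ p) (inj₂ q) = y₂≢y₄ (trans p (sym q))

-- the neighbourhood of the new vertex of G₄ is {a, b, c, d}
G₄-apex-noP₄ : ∀ {k a b c d} → InducesP₃⊔K₁ (Square (Cyc k)) a b c d →
  ¬ NeighbourhoodP₄ (G₄ k a b c d) (inj₂ tt)
G₄-apex-noP₄ {k} ind (p₄ (inj₁ _) (inj₁ _) (inj₁ _) (inj₁ _) n₁ n₂ n₃ n₄ y₁y₂ y₂y₃ y₃y₄ y₁≢y₃ y₁≢y₄ y₂≢y₄) =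
  P₃⊔K₁-noP₄ (Square (Cyc k)) ind n₁ n₂ n₃ n₄ y₁y₂ y₂y₃ y₃y₄
    (y₁≢y₃ ∘ cong inj₁) (y₁≢y₄ ∘ cong inj₁) (y₂≢y₄ ∘ cong inj₁)
G₄-apex-noP₄ ind (p₄ (inj₂ _) _ _ _ () _ _ _ _ _ _ _ _ _)
G₄-apex-noP₄ ind (p₄ (inj₁ _) (inj₂ _) _ _ _ () _ _ _ _ _ _ _ _)
G₄-apex-noP₄ ind (p₄ (inj₁ _) (inj₁ _) (inj₂ _) _ _ _ () _ _ _ _ _ _ _)
G₄-apex-noP₄ ind (p₄ (inj₁ _) (inj₁ _) (inj₁ _) (inj₂ _) _ _ _ () _ _ _ _ _ _)

-- the five distinct vertices v₄, a, b, c, d make the cycle long enough for neighbourhoodP₄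
partC : ∀ (k : ℕ) (a b c d : Fin (3 + k)) → InducesP₃⊔K₁ (Square (Cyc k)) a b c d →
  ¬ HasH² (G₄ k a b c d)
partC k a b c d ind@((a≢b , a≢c , a≢d , b≢c , b≢d , c≢d) , _) H =
  G₄-apex-noP₄ ind (neighbourhoodP₄ (lengthBound vertices distinct) (inj₂ tt))
  where
  open SquaredCycle (G₄ k a b c d) H using (neighbourhoodP₄; lengthBound)
  vertices : List (V (G₄ k a b c d))
  vertices = inj₂ tt ∷ inj₁ a ∷ inj₁ b ∷ inj₁ c ∷ inj₁ d ∷ []
  old : ∀ {x y : Fin (3 + k)} → x ≢ y → inj₁ x ≢ inj₁ y
  old x≢y = x≢y ∘ inj₁-injective
  distinct : Unique vertices
  distinct = ((λ ()) ∷ (λ ()) ∷ (λ ()) ∷ (λ ()) ∷ []) ∷ (old a≢b ∷ old a≢c ∷ old a≢d ∷ [])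
           ∷ (old b≢c ∷ old b≢d ∷ []) ∷ (old c≢d ∷ []) ∷ [] ∷ []

-- (d) G₅: the children of the root are pairwise non-adjacent, so the root lies in no triangle
root-noTriangle : ¬ (∃₂ λ x y → G₅Adj root x × G₅Adj root y × G₅Adj x y)
root-noTriangle (mid _ , mid _ , _ , _ , ())

partD : ¬ HasH² G₅
partD H = root-noTriangle (adjacentNeighbours root)
  where open SquaredCycle G₅ H

K₂-twoValued : (a b c : Fin 2) → a ≢ b → b ≢ c → a ≡ c
K₂-twoValued zero       zero       _          a≢b _   = ⊥-elim (a≢b refl)
K₂-twoValued (suc zero) (suc zero) _          a≢b _   = ⊥-elim (a≢b refl)
K₂-twoValued _          zero       zero       _   b≢c = ⊥-elim (b≢c refl)
K₂-twoValued _          (suc zero) (suc zero) _   b≢c = ⊥-elim (b≢c refl)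
K₂-twoValued zero       (suc zero) zero       _   _   = refl
K₂-twoValued (suc zero) zero       (suc zero) _   _   = refl

K₂⊔K₂-noP₃ : ∀ {x y z : V (K 2 ⊔ K 2)} → _~_ (K 2 ⊔ K 2) x y → _~_ (K 2 ⊔ K 2) y z → x ≢ z → ⊥
K₂⊔K₂-noP₃ {inj₁ a} {inj₁ b} {inj₁ c} a≢b b≢c x≢z = x≢z (cong inj₁ (K₂-twoValued a b c a≢b b≢c))
K₂⊔K₂-noP₃ {inj₂ a} {inj₂ b} {inj₂ c} a≢b b≢c x≢z = x≢z (cong inj₂ (K₂-twoValued a b c a≢b b≢c))
K₂⊔K₂-noP₃ {inj₁ _} {inj₂ _} ()
K₂⊔K₂-noP₃ {inj₂ _} {inj₁ _} ()
K₂⊔K₂-noP₃ {inj₁ _} {inj₁ _} {inj₂ _} _ ()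
K₂⊔K₂-noP₃ {inj₂ _} {inj₂ _} {inj₁ _} _ ()

K₁-isolated : ∀ {m} (u : V (K m ⊔ K 1)) → ¬ _~_ (K m ⊔ K 1) (inj₂ zero) u
K₁-isolated (inj₁ _) ()
K₁-isolated (inj₂ zero) z≢z = z≢z refl

-- so its neighbourhood in G₆ is K₂ ⊔ K₂
G₆-apex-noP₄ : ∀ {m} → ¬ NeighbourhoodP₄ ((K 2 ⊔ K 2) +ᴳ (K m ⊔ K 1)) (inj₂ (inj₂ zero))
G₆-apex-noP₄ (p₄ (inj₁ _) (inj₁ _) (inj₁ _) _ _ _ _ _ x₁x₂ x₂x₃ _ x₁≢x₃ _ _) =
  K₂⊔K₂-noP₃ x₁x₂ x₂x₃ (x₁≢x₃ ∘ cong inj₁)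
G₆-apex-noP₄ (p₄ (inj₂ u) _ _ _ w~x₁ _ _ _ _ _ _ _ _ _) = K₁-isolated u w~x₁
G₆-apex-noP₄ (p₄ (inj₁ _) (inj₂ u) _ _ _ w~x₂ _ _ _ _ _ _ _ _) = K₁-isolated u w~x₂
G₆-apex-noP₄ (p₄ (inj₁ _) (inj₁ _) (inj₂ u) _ _ _ w~x₃ _ _ _ _ _ _ _) = K₁-isolated u w~x₃

-- five distinct vertices again give a cycle of length at least 5
partE : ∀ (m : ℕ) → 4 ≤ m → ¬ HasH² ((K 2 ⊔ K 2) +ᴳ (K m ⊔ K 1))
partE m _ H = G₆-apex-noP₄ (neighbourhoodP₄ (lengthBound vertices distinct) (inj₂ (inj₂ zero)))
  where
  open SquaredCycle ((K 2 ⊔ K 2) +ᴳ (K m ⊔ K 1)) H using (neighbourhoodP₄; lengthBound)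
  vertices : List ((Fin 2 ⊎ Fin 2) ⊎ (Fin m ⊎ Fin 1))
  vertices = inj₁ (inj₁ zero) ∷ inj₁ (inj₁ (suc zero)) ∷ inj₁ (inj₂ zero) ∷ inj₁ (inj₂ (suc zero))
           ∷ inj₂ (inj₂ zero) ∷ []
  distinct : Unique vertices
  distinct = ((λ ()) ∷ (λ ()) ∷ (λ ()) ∷ (λ ()) ∷ []) ∷ ((λ ()) ∷ (λ ()) ∷ (λ ()) ∷ [])
           ∷ ((λ ()) ∷ (λ ()) ∷ []) ∷ ((λ ()) ∷ []) ∷ [] ∷ []

lemma1 :
    (∀ (m : ℕ) → 4 ≤ m → (π : Permutation′ m) → ¬ HasH² (G₂ m π)) ×
    (∀ (m : ℕ) → 4 ≤ m → ¬ HasH² (K m +ᴳ co (K (m ∸ 1)))) ×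
    (∀ (k : ℕ) (a b c d : Fin (3 + k)) → InducesP₃⊔K₁ (Square (Cyc k)) a b c d →
      ¬ HasH² (G₄ k a b c d)) ×
    ¬ HasH² G₅ ×
    (∀ (m : ℕ) → 4 ≤ m → ¬ HasH² ((K 2 ⊔ K 2) +ᴳ (K m ⊔ K 1)))
lemma1 = partA , partB , partC , partD , partE
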